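{- Let $r\ge 0$ be an integer, $R=2^r$, $W=\sqrt{R^2+2R}$, $\lambda=\frac{R+W}{2}$, $\mu=\frac{R-W}{2}$, and for every integer $n$ let $P_R(n)=\frac{2}{RW}(\lambda^n-\mu^n)$. For an integer $m\ge1$ put \[ a=2^mP_R(m),\quad b=2^m,\quad c=-\Bigl(R(R+1)2^{m-1}P_R(m)-R^22^{m-2}P_R(m-2)\Bigr),\quad d=(-1)^mR^m . \] Then $b+c+d\neq0$ and for every integer $n\ge0$, \[ \sum_{k=0}^{n}P_R(km)=\frac{a}{b+c+d}-\frac{1}{b+c+d}\Bigl(bP_R(m(n+1))-dP_R(mn)\Bigr). \]
   Context: $P_R(n)$ are the (shifted) generalized $r$-Pell numbers, with $P_R(0)=0$, $P_R(1)=2/R$, $P_R(2)=2$ and $2P_R(n+2)=2RP_R(n+1)+RP_R(n)$. The Binet formula defines $P_R(n)$ also for negative $n$ (e.g. $P_R(-1)=4/R^2$, used when $m=1$). -}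

module Defs where

open import Data.Nat as ℕ using (ℕ; zero; suc)
open import Data.Integer as ℤ using (ℤ; +_; -[1+_])
open import Data.Rational using (ℚ; 0ℚ; 1ℚ; ½; _+_; _*_; _-_; _÷_; -_)

_^ℚ_ : ℚ → ℕ → ℚ
x ^ℚ zero    = 1ℚ
x ^ℚ (suc n) = x * (x ^ℚ n)

ℕ→ℚ : ℕ → ℚ
ℕ→ℚ n = Data.Rational.mkℚ (+ n) 0 (Data.Nat.Coprimality.sym (Data.Nat.Coprimality.1-coprimeTo n))
  where import Data.Nat.Coprimality

pow2 : ℤ → ℚ
pow2 (+ n)      = ℕ→ℚ 2 ^ℚ n
pow2 -[1+ k ]   = ½ ^ℚ suc k

Rq : ℕ → ℚ
Rq r = ℕ→ℚ 2 ^ℚ r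

Rinv : ℕ → ℚ
Rinv r = ½ ^ℚ r

Ppos : ℕ → ℕ → ℚ
Ppos r zero          = 0ℚ
Ppos r (suc zero)    = ℕ→ℚ 2 * Rinv r
Ppos r (suc (suc n)) = Rq r * Ppos r (suc n) + (Rq r * ½) * Ppos r n

-- Backward values: Pneg r k = P_R(-k), obtained from the same recurrence run
-- backwards (this is exactly what the Binet formula gives for negative indices):
-- P_R(n) = (2 P_R(n+2) - 2R P_R(n+1)) / R.
Pneg : ℕ → ℕ → ℚ
Pneg r zero          = 0ℚ
Pneg r (suc zero)    = ℕ→ℚ 4 * (Rinv r * Rinv r)
Pneg r (suc (suc k)) = (ℕ→ℚ 2 * Pneg r k - ℕ→ℚ 2 * Rq r * Pneg r (suc k)) * Rinv r

P : ℕ → ℤ → ℚ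
P r (+ n)     = Ppos r n
P r -[1+ k ]  = Pneg r (suc k)

sumTo : (ℕ → ℚ) → ℕ → ℚ
sumTo f zero    = f zero
sumTo f (suc n) = sumTo f n + f (suc n)

coefA coefB coefC coefD : ℕ → ℕ → ℚ
coefA r m = pow2 (+ m) * P r (+ m)
coefB r m = pow2 (+ m)
coefC r m = - ( Rq r * (Rq r + 1ℚ) * pow2 (+ m ℤ.- + 1) * P r (+ m)
              - Rq r * Rq r * pow2 (+ m ℤ.- + 2) * P r (+ m ℤ.- + 2) )
coefD r m = (- 1ℚ) ^ℚ m * Rq r ^ℚ m

{-# OPTIONS --safe #-}
-- P_R solves x(n+2) = R x(n+1) + (R/2) x(n), with characteristic roots λ, μ, λ + μ = R, λμ = -R/2.
-- Then k ↦ P_R(km) solves the recurrence with roots λ^m, μ^m, namely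
-- x(k+2) = V_m x(k+1) - (λμ)^m x(k) with V_m = λ^m + μ^m the Lucas sequence; this is proved
-- without irrationals via Cassini's identity for the companion sequence U. Summing any second-order
-- recurrence telescopes, (p + q - 1) Σ_{k≤n} x(k) = x(n+1) + q x(n) - x(1) + (p - 1) x(0), and
-- b + c + d = -2^m (V_m - (λμ)^m - 1) = -2^m (λ^m - 1)(1 - μ^m) < 0.
module Submission where

open import Defs
open import Data.Nat using (ℕ; _≥_; suc; zero)
import Data.Nat as N
import Data.Nat.Properties as NP
open import Data.Integer using (+_)
open import Data.Rational
  using (ℚ; 0ℚ; 1ℚ; ½; _+_; _-_; _*_; _÷_; -_; 1/_; _≤_; _<_; NonZero; ≢-nonZero; positive; nonNegative)
import Data.Rational.Properties as QP
open import Data.Product using (Σ; _,_; _×_; proj₁; proj₂)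
open import Relation.Binary.PropositionalEquality
  using (_≡_; _≢_; refl; sym; trans; cong; cong₂; subst; module ≡-Reasoning)
open import Relation.Nullary.Decidable.Core using (dec⇒maybe)
open import Tactic.RingSolver using (solve-∀)
open import Tactic.RingSolver.Core.AlmostCommutativeRing using (AlmostCommutativeRing; fromCommutativeRing)
open import Level using (0ℓ)

open ≡-Reasoning

ℚ-ring : AlmostCommutativeRing 0ℓ 0ℓ
ℚ-ring = fromCommutativeRing QP.+-*-commutativeRing (λ x → dec⇒maybe (0ℚ QP.≟ x))

module LinearRecurrence (p q : ℚ) where

  Solves : (ℕ → ℚ) → Set
  Solves f = ∀ n → f (suc (suc n)) ≡ p * f (suc n) + q * f n

  solutions-unique : ∀ {f g} → Solves f → Solves g → f 0 ≡ g 0 → f 1 ≡ g 1 → ∀ n → f n ≡ g n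
  solutions-unique sf sg e₀ e₁ zero          = e₀
  solutions-unique sf sg e₀ e₁ (suc zero)    = e₁
  solutions-unique {f} {g} sf sg e₀ e₁ (suc (suc n)) = begin
    f (suc (suc n))             ≡⟨ sf n ⟩
    p * f (suc n) + q * f n     ≡⟨ cong₂ (λ a b → p * a + q * b)
                                     (solutions-unique sf sg e₀ e₁ (suc n)) (solutions-unique sf sg e₀ e₁ n) ⟩
    p * g (suc n) + q * g n     ≡⟨ sym (sg n) ⟩
    g (suc (suc n))             ∎

  suc-solves : ∀ {f} → Solves f → Solves (λ n → f (suc n))
  suc-solves sf n = sf (suc n)

  *-solves : ∀ {f} c → Solves f → Solves (λ n → c * f n)
  *-solves {f} c sf n = trans (cong (c *_) (sf n)) (distrib p q c (f (suc n)) (f n))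
    where
    distrib : ∀ p q c x y → c * (p * x + q * y) ≡ p * (c * x) + q * (c * y)
    distrib = solve-∀ ℚ-ring

  +-solves : ∀ {f g} → Solves f → Solves g → Solves (λ n → f n + g n)
  +-solves {f} {g} sf sg n =
    trans (cong₂ _+_ (sf n) (sg n)) (regroup p q (f (suc n)) (f n) (g (suc n)) (g n))
    where
    regroup : ∀ p q x y z w → (p * x + q * y) + (p * z + q * w) ≡ p * (x + z) + q * (y + w)
    regroup = solve-∀ ℚ-ring

  -- The Lucas sequences U(P, Q) and V(P, Q) for P = p, Q = - q.
  lucasU : ℕ → ℚ
  lucasU zero          = 0ℚ
  lucasU (suc zero)    = 1ℚ
  lucasU (suc (suc n)) = p * lucasU (suc n) + q * lucasU n

  lucasV : ℕ → ℚ
  lucasV zero          = ℕ→ℚ 2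
  lucasV (suc zero)    = p
  lucasV (suc (suc n)) = p * lucasV (suc n) + q * lucasV n

  lucasU-solves : Solves lucasU
  lucasU-solves n = refl

  lucasV-solves : Solves lucasV
  lucasV-solves n = refl

  lucasV-suc : ∀ m → lucasV (suc m) ≡ lucasU (suc (suc m)) + q * lucasU m
  lucasV-suc = solutions-unique (suc-solves lucasV-solves)
    (+-solves (suc-solves (suc-solves lucasU-solves)) (*-solves q lucasU-solves))
    (init₁ p q) (init₂ p q)
    where
    init₁ : ∀ p q → p ≡ (p * 1ℚ + q * 0ℚ) + q * 0ℚ
    init₁ = solve-∀ ℚ-ring
    init₂ : ∀ p q → p * p + q * ℕ→ℚ 2 ≡ (p * (p * 1ℚ + q * 0ℚ) + q * 1ℚ) + q * 1ℚ
    init₂ = solve-∀ ℚ-ring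

  shift-decomposition : ∀ {f} → Solves f → ∀ m j →
    f (suc m N.+ j) ≡ lucasU (suc m) * f (suc j) + q * lucasU m * f j
  shift-decomposition {f} sf zero j = base (f (suc j)) (f j) q
    where
    base : ∀ x y q → x ≡ 1ℚ * x + q * 0ℚ * y
    base = solve-∀ ℚ-ring
  shift-decomposition {f} sf (suc m) j = begin
    f (suc (suc m N.+ j))
      ≡⟨ shift m ⟩
    lucasU (suc m) * f (suc (suc j)) + q * lucasU m * f (suc j)
      ≡⟨ cong (λ z → lucasU (suc m) * z + q * lucasU m * f (suc j)) (sf j) ⟩
    lucasU (suc m) * (p * f (suc j) + q * f j) + q * lucasU m * f (suc j)
      ≡⟨ regroup p q (lucasU (suc m)) (lucasU m) (f (suc j)) (f j) ⟩
    lucasU (suc (suc m)) * f (suc j) + q * lucasU (suc m) * f j ∎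
    where
    shift : ∀ m → f (suc (suc m N.+ j)) ≡ lucasU (suc m) * f (suc (suc j)) + q * lucasU m * f (suc j)
    shift m = trans (cong f (sym (NP.+-suc (suc m) j))) (shift-decomposition sf m (suc j))
    regroup : ∀ p q u₁ u₀ x y →
      u₁ * (p * x + q * y) + q * u₀ * x ≡ (p * u₁ + q * u₀) * x + q * u₁ * y
    regroup = solve-∀ ℚ-ring

  cassini : ∀ m → lucasU (suc m) * lucasU (suc m) - lucasU (suc (suc m)) * lucasU m ≡ (- q) ^ℚ m
  cassini zero    = cassini₀ p q
    where
    cassini₀ : ∀ p q → 1ℚ * 1ℚ - (p * 1ℚ + q * 0ℚ) * 0ℚ ≡ 1ℚ
    cassini₀ = solve-∀ ℚ-ring
  cassini (suc m) = begin
    lucasU (suc (suc m)) * lucasU (suc (suc m)) - lucasU (suc (suc (suc m))) * lucasU (suc m)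
      ≡⟨ step p q (lucasU (suc m)) (lucasU m) ⟩
    (- q) * (lucasU (suc m) * lucasU (suc m) - lucasU (suc (suc m)) * lucasU m)
      ≡⟨ cong ((- q) *_) (cassini m) ⟩
    (- q) * (- q) ^ℚ m ∎
    where
    step : ∀ p q u₁ u₀ →
      (p * u₁ + q * u₀) * (p * u₁ + q * u₀) - (p * (p * u₁ + q * u₀) + q * u₁) * u₁
        ≡ (- q) * (u₁ * u₁ - (p * u₁ + q * u₀) * u₀)
    step = solve-∀ ℚ-ring

  sumTo-solution : ∀ {f} → Solves f → ∀ n →
    sumTo f n * (p + q - 1ℚ) ≡ f (suc n) + q * f n - f 1 + f 0 * (p - 1ℚ)
  sumTo-solution {f} sf zero = base p q (f 0) (f 1)
    where
    base : ∀ p q x₀ x₁ → x₀ * (p + q - 1ℚ) ≡ x₁ + q * x₀ - x₁ + x₀ * (p - 1ℚ)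
    base = solve-∀ ℚ-ring
  sumTo-solution {f} sf (suc n) = begin
    (sumTo f n + f (suc n)) * (p + q - 1ℚ)
      ≡⟨ QP.*-distribʳ-+ (p + q - 1ℚ) (sumTo f n) (f (suc n)) ⟩
    sumTo f n * (p + q - 1ℚ) + f (suc n) * (p + q - 1ℚ)
      ≡⟨ cong (_+ f (suc n) * (p + q - 1ℚ)) (sumTo-solution sf n) ⟩
    (f (suc n) + q * f n - f 1 + f 0 * (p - 1ℚ)) + f (suc n) * (p + q - 1ℚ)
      ≡⟨ regroup p q (f (suc n)) (f n) (f 1) (f 0) ⟩
    (p * f (suc n) + q * f n) + q * f (suc n) - f 1 + f 0 * (p - 1ℚ)
      ≡⟨ cong (λ z → z + q * f (suc n) - f 1 + f 0 * (p - 1ℚ)) (sym (sf n)) ⟩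
    f (suc (suc n)) + q * f (suc n) - f 1 + f 0 * (p - 1ℚ) ∎
    where
    regroup : ∀ p q x y x₁ x₀ →
      (x + q * y - x₁ + x₀ * (p - 1ℚ)) + x * (p + q - 1ℚ)
        ≡ (p * x + q * y) + q * x - x₁ + x₀ * (p - 1ℚ)
    regroup = solve-∀ ℚ-ring

module _ (p q : ℚ) where
  open LinearRecurrence p q

  stride-solves : ∀ {f} → Solves f → ∀ m →
    LinearRecurrence.Solves (lucasV m) (- ((- q) ^ℚ m)) (λ k → f (k N.* m))
  stride-solves {f} sf zero n = collapse (f (n N.* 0))
    where
    collapse : ∀ x → x ≡ ℕ→ℚ 2 * x + - 1ℚ * x
    collapse = solve-∀ ℚ-ring
  stride-solves {f} sf (suc m) n = begin
    f (suc m N.+ j′)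
      ≡⟨ shift-decomposition sf m j′ ⟩
    lucasU (suc m) * f (suc j′) + q * lucasU m * f j′
      ≡⟨ regroup q (lucasU (suc (suc m))) (lucasU (suc m)) (lucasU m) (f (suc j′)) (f j′) ⟩
    (lucasU (suc (suc m)) + q * lucasU m) * f j′
      + (lucasU (suc m) * f (suc j′) - lucasU (suc (suc m)) * f j′)
      ≡⟨ cong₂ (λ v c → v * f j′ + c) (sym (lucasV-suc m)) cross-term ⟩
    lucasV (suc m) * f j′ + - ((- q) ^ℚ suc m) * f j ∎
    where
    j  = n N.* suc m
    j′ = suc m N.+ j
    regroup : ∀ q u₂ u₁ u₀ x y → u₁ * x + q * u₀ * y ≡ (u₂ + q * u₀) * y + (u₁ * x - u₂ * y)
    regroup = solve-∀ ℚ-ring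
    expand : ∀ q u₂ u₁ u₀ x y →
      u₁ * (u₂ * x + q * u₁ * y) - u₂ * (u₁ * x + q * u₀ * y) ≡ - ((- q) * (u₁ * u₁ - u₂ * u₀)) * y
    expand = solve-∀ ℚ-ring
    cross-term : lucasU (suc m) * f (suc j′) - lucasU (suc (suc m)) * f j′ ≡ - ((- q) ^ℚ suc m) * f j
    cross-term = begin
      lucasU (suc m) * f (suc j′) - lucasU (suc (suc m)) * f j′
        ≡⟨ cong₂ (λ a b → lucasU (suc m) * a - lucasU (suc (suc m)) * b)
             (shift-decomposition sf (suc m) j) (shift-decomposition sf m j) ⟩
      lucasU (suc m) * (lucasU (suc (suc m)) * f (suc j) + q * lucasU (suc m) * f j)
        - lucasU (suc (suc m)) * (lucasU (suc m) * f (suc j) + q * lucasU m * f j)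
        ≡⟨ expand q (lucasU (suc (suc m))) (lucasU (suc m)) (lucasU m) (f (suc j)) (f j) ⟩
      - ((- q) * (lucasU (suc m) * lucasU (suc m) - lucasU (suc (suc m)) * lucasU m)) * f j
        ≡⟨ cong (λ c → - ((- q) * c) * f j) (cassini m) ⟩
      - ((- q) ^ℚ suc m) * f j ∎

*≡⇒≡÷ : ∀ {S D} A Y .{{_ : NonZero D}} → S * D ≡ A - Y → S ≡ A ÷ D - Y ÷ D
*≡⇒≡÷ {S} {D} A Y S*D≡A-Y = begin
  S                   ≡⟨ sym (QP.*-identityʳ S) ⟩
  S * 1ℚ              ≡⟨ cong (S *_) (sym (QP.*-inverseʳ D)) ⟩
  S * (D * 1/ D)      ≡⟨ sym (QP.*-assoc S D (1/ D)) ⟩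
  (S * D) * 1/ D      ≡⟨ cong (_* 1/ D) S*D≡A-Y ⟩
  (A - Y) * 1/ D      ≡⟨ distrib A Y (1/ D) ⟩
  A * 1/ D - Y * 1/ D ∎
  where
  distrib : ∀ a b c → (a - b) * c ≡ a * c - b * c
  distrib = solve-∀ ℚ-ring

*-nonNeg : ∀ {a b} → 0ℚ ≤ a → 0ℚ ≤ b → 0ℚ ≤ a * b
*-nonNeg {a} {b} 0≤a 0≤b =
  QP.nonNegative⁻¹ _ {{QP.nonNeg*nonNeg⇒nonNeg a {{nonNegative 0≤a}} b {{nonNegative 0≤b}}}}

*-pos : ∀ {a b} → 0ℚ < a → 0ℚ < b → 0ℚ < a * b
*-pos {a} {b} 0<a 0<b = QP.positive⁻¹ _ {{QP.pos*pos⇒pos a {{positive 0<a}} b {{positive 0<b}}}}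

^ℚ-*-distrib : ∀ x y m → (x * y) ^ℚ m ≡ x ^ℚ m * y ^ℚ m
^ℚ-*-distrib x y zero    = refl
^ℚ-*-distrib x y (suc m) = begin
  (x * y) * (x * y) ^ℚ m       ≡⟨ cong ((x * y) *_) (^ℚ-*-distrib x y m) ⟩
  (x * y) * (x ^ℚ m * y ^ℚ m)  ≡⟨ interchange x y (x ^ℚ m) (y ^ℚ m) ⟩
  (x * x ^ℚ m) * (y * y ^ℚ m)  ∎
  where
  interchange : ∀ a b c d → (a * b) * (c * d) ≡ (a * c) * (b * d)
  interchange = solve-∀ ℚ-ring

^ℚ-pos : ∀ {x} → 0ℚ < x → ∀ m → 0ℚ < x ^ℚ m
^ℚ-pos 0<x zero    = QP.positive⁻¹ 1ℚ
^ℚ-pos 0<x (suc m) = *-pos 0<x (^ℚ-pos 0<x m)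

^ℚ-dominates-neg-^ℚ : ∀ {x} → 0ℚ ≤ x → ∀ m →
  0ℚ ≤ x ^ℚ m + (- x) ^ℚ m × 0ℚ ≤ x ^ℚ m - (- x) ^ℚ m
^ℚ-dominates-neg-^ℚ 0≤x zero    = QP.nonNegative⁻¹ (1ℚ + 1ℚ) , QP.≤-refl
^ℚ-dominates-neg-^ℚ {x} 0≤x (suc m) =
  subst (0ℚ ≤_) (sym (sum x (x ^ℚ m) ((- x) ^ℚ m))) (*-nonNeg 0≤x (proj₂ ih)) ,
  subst (0ℚ ≤_) (sym (difference x (x ^ℚ m) ((- x) ^ℚ m))) (*-nonNeg 0≤x (proj₁ ih))
  where
  ih = ^ℚ-dominates-neg-^ℚ 0≤x m
  sum : ∀ x a b → x * a + (- x) * b ≡ x * (a - b)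
  sum = solve-∀ ℚ-ring
  difference : ∀ x a b → x * a - (- x) * b ≡ x * (a + b)
  difference = solve-∀ ℚ-ring

R*Rinv≡1 : ∀ r → Rq r * Rinv r ≡ 1ℚ
R*Rinv≡1 zero    = refl
R*Rinv≡1 (suc r) = trans (halve (Rq r) (Rinv r)) (R*Rinv≡1 r)
  where
  halve : ∀ a b → (ℕ→ℚ 2 * a) * (½ * b) ≡ a * b
  halve = solve-∀ ℚ-ring

0≤R-1 : ∀ r → 0ℚ ≤ Rq r - 1ℚ
0≤R-1 zero    = QP.≤-refl
0≤R-1 (suc r) = subst (0ℚ ≤_) (sym (double (Rq r)))
  (QP.+-mono-≤ (QP.+-mono-≤ (0≤R-1 r) (0≤R-1 r)) (QP.nonNegative⁻¹ 1ℚ))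
  where
  double : ∀ a → ℕ→ℚ 2 * a - 1ℚ ≡ ((a - 1ℚ) + (a - 1ℚ)) + 1ℚ
  double = solve-∀ ℚ-ring

module GeneralizedPell (r : ℕ) where

  R s : ℚ
  R = Rq r
  s = R * ½

  open LinearRecurrence R s

  Ppos-solves : Solves (Ppos r)
  Ppos-solves n = refl

  R*Ppos≡2*lucasU : ∀ n → R * Ppos r n ≡ ℕ→ℚ 2 * lucasU n
  R*Ppos≡2*lucasU = solutions-unique (*-solves R Ppos-solves) (*-solves (ℕ→ℚ 2) lucasU-solves)
    (QP.*-zeroʳ R)
    (begin
      R * (ℕ→ℚ 2 * Rinv r) ≡⟨ swap R (Rinv r) ⟩
      ℕ→ℚ 2 * (R * Rinv r) ≡⟨ cong (ℕ→ℚ 2 *_) (R*Rinv≡1 r) ⟩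
      ℕ→ℚ 2 * 1ℚ           ∎)
    where
    swap : ∀ a b → a * (ℕ→ℚ 2 * b) ≡ ℕ→ℚ 2 * (a * b)
    swap = solve-∀ ℚ-ring

  coefC≡ : ∀ m → m ≥ 1 → coefC r m ≡ - (coefB r m * lucasV m)
  coefC≡ (suc zero) _ = begin
    - (R * (R + 1ℚ) * 1ℚ * (ℕ→ℚ 2 * ρ) - R * R * (½ * 1ℚ) * (ℕ→ℚ 4 * (ρ * ρ)))
      ≡⟨ collect R ρ ⟩
    - (ℕ→ℚ 2 * (R + 1ℚ) * (R * ρ) - ℕ→ℚ 2 * ((R * ρ) * (R * ρ)))
      ≡⟨ cong (λ t → - (ℕ→ℚ 2 * (R + 1ℚ) * t - ℕ→ℚ 2 * (t * t))) (R*Rinv≡1 r) ⟩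
    - (ℕ→ℚ 2 * (R + 1ℚ) * 1ℚ - ℕ→ℚ 2 * (1ℚ * 1ℚ))
      ≡⟨ simplify R ⟩
    - (ℕ→ℚ 2 * 1ℚ * R) ∎
    where
    ρ = Rinv r
    collect : ∀ R ρ →
      - (R * (R + 1ℚ) * 1ℚ * (ℕ→ℚ 2 * ρ) - R * R * (½ * 1ℚ) * (ℕ→ℚ 4 * (ρ * ρ)))
        ≡ - (ℕ→ℚ 2 * (R + 1ℚ) * (R * ρ) - ℕ→ℚ 2 * ((R * ρ) * (R * ρ)))
    collect = solve-∀ ℚ-ring
    simplify : ∀ R → - (ℕ→ℚ 2 * (R + 1ℚ) * 1ℚ - ℕ→ℚ 2 * (1ℚ * 1ℚ)) ≡ - (ℕ→ℚ 2 * 1ℚ * R)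
    simplify = solve-∀ ℚ-ring
  coefC≡ (suc (suc k)) _ = begin
    - (R * (R + 1ℚ) * (ℕ→ℚ 2 * u) * Ppos r (suc (suc k)) - R * R * u * Ppos r k)
      ≡⟨ collect R u (Ppos r (suc (suc k))) (Ppos r k) ⟩
    - ((R + 1ℚ) * (ℕ→ℚ 2 * u) * (R * Ppos r (suc (suc k))) - R * u * (R * Ppos r k))
      ≡⟨ cong₂ (λ a b → - ((R + 1ℚ) * (ℕ→ℚ 2 * u) * a - R * u * b))
           (R*Ppos≡2*lucasU (suc (suc k))) (R*Ppos≡2*lucasU k) ⟩
    - ((R + 1ℚ) * (ℕ→ℚ 2 * u) * (ℕ→ℚ 2 * lucasU (suc (suc k))) - R * u * (ℕ→ℚ 2 * lucasU k))
      ≡⟨ regroup R u (lucasU (suc k)) (lucasU k) ⟩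
    - ((ℕ→ℚ 2 * (ℕ→ℚ 2 * u)) * (lucasU (suc (suc (suc k))) + s * lucasU (suc k)))
      ≡⟨ cong (λ v → - ((ℕ→ℚ 2 * (ℕ→ℚ 2 * u)) * v)) (sym (lucasV-suc (suc k))) ⟩
    - (coefB r (suc (suc k)) * lucasV (suc (suc k))) ∎
    where
    u = ℕ→ℚ 2 ^ℚ k
    collect : ∀ R u a b → - (R * (R + 1ℚ) * (ℕ→ℚ 2 * u) * a - R * R * u * b)
      ≡ - ((R + 1ℚ) * (ℕ→ℚ 2 * u) * (R * a) - R * u * (R * b))
    collect = solve-∀ ℚ-ring
    regroup : ∀ R u a b →
      - ((R + 1ℚ) * (ℕ→ℚ 2 * u) * (ℕ→ℚ 2 * (R * a + R * ½ * b)) - R * u * (ℕ→ℚ 2 * b))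
        ≡ - ((ℕ→ℚ 2 * (ℕ→ℚ 2 * u)) * ((R * (R * a + R * ½ * b) + R * ½ * a) + R * ½ * a))
    regroup = solve-∀ ℚ-ring

  coefD≡ : ∀ m → coefD r m ≡ coefB r m * (- s) ^ℚ m
  coefD≡ m = begin
    (- 1ℚ) ^ℚ m * R ^ℚ m         ≡⟨ sym (^ℚ-*-distrib (- 1ℚ) R m) ⟩
    ((- 1ℚ) * R) ^ℚ m            ≡⟨ cong (_^ℚ m) (split R) ⟩
    (ℕ→ℚ 2 * (- s)) ^ℚ m         ≡⟨ ^ℚ-*-distrib (ℕ→ℚ 2) (- s) m ⟩
    ℕ→ℚ 2 ^ℚ m * (- s) ^ℚ m      ∎
    where
    split : ∀ R → (- 1ℚ) * R ≡ ℕ→ℚ 2 * (- (R * ½))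
    split = solve-∀ ℚ-ring

  0<R : 0ℚ < R
  0<R = subst (0ℚ <_) (sym (shift R)) (QP.+-mono-≤-< (0≤R-1 r) (QP.positive⁻¹ 1ℚ))
    where
    shift : ∀ a → a ≡ (a - 1ℚ) + 1ℚ
    shift = solve-∀ ℚ-ring

  0<s : 0ℚ < s
  0<s = *-pos 0<R (QP.positive⁻¹ ½)

  0≤lucasV : ∀ m → 0ℚ ≤ lucasV m
  0≤lucasV zero          = QP.nonNegative⁻¹ (ℕ→ℚ 2)
  0≤lucasV (suc zero)    = QP.<⇒≤ 0<R
  0≤lucasV (suc (suc m)) =
    QP.+-mono-≤ (*-nonNeg (QP.<⇒≤ 0<R) (0≤lucasV (suc m))) (*-nonNeg (QP.<⇒≤ 0<s) (0≤lucasV m))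

  0<V-1-sᵐ : ∀ k → 0ℚ < lucasV (suc (suc k)) - 1ℚ - s ^ℚ suc (suc k)
  0<V-1-sᵐ zero = subst (0ℚ <_) (sym (base R))
    (QP.+-mono-<-≤ (*-pos (*-pos 0<s 0<s) (QP.positive⁻¹ (ℕ→ℚ 3))) (0≤R-1 r))
    where
    base : ∀ R → (R * R + R * ½ * ℕ→ℚ 2) - 1ℚ - R * ½ * (R * ½ * 1ℚ)
      ≡ (R * ½) * (R * ½) * ℕ→ℚ 3 + (R - 1ℚ)
    base = solve-∀ ℚ-ring
  0<V-1-sᵐ (suc k) = subst (0ℚ <_) (sym (step R (lucasV (suc (suc k))) (lucasV (suc k)) sᵏ⁺²))
    (QP.+-mono-<-≤ (*-pos 0<R (0<V-1-sᵐ k))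
      (QP.+-mono-≤
        (QP.+-mono-≤ (0≤R-1 r) (*-nonNeg (QP.<⇒≤ 0<s) (QP.<⇒≤ (^ℚ-pos 0<s (suc (suc k))))))
        (*-nonNeg (QP.<⇒≤ 0<s) (0≤lucasV (suc k)))))
    where
    sᵏ⁺² = s ^ℚ suc (suc k)
    step : ∀ R v₂ v₁ t → (R * v₂ + R * ½ * v₁) - 1ℚ - R * ½ * t
      ≡ R * (v₂ - 1ℚ - t) + (((R - 1ℚ) + R * ½ * t) + R * ½ * v₁)
    step = solve-∀ ℚ-ring

  0<V-[-s]ᵐ-1 : ∀ m → m ≥ 1 → 0ℚ < lucasV m - (- s) ^ℚ m - 1ℚ
  0<V-[-s]ᵐ-1 (suc zero) _ = subst (0ℚ <_) (sym (base R)) (QP.+-mono-≤-< (0≤R-1 r) 0<s)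
    where
    base : ∀ R → R - (- (R * ½)) * 1ℚ - 1ℚ ≡ (R - 1ℚ) + R * ½
    base = solve-∀ ℚ-ring
  0<V-[-s]ᵐ-1 (suc (suc k)) _ = subst (0ℚ <_) (sym (split (lucasV m) ((- s) ^ℚ m) (s ^ℚ m)))
    (QP.+-mono-<-≤ (0<V-1-sᵐ k) (proj₂ (^ℚ-dominates-neg-^ℚ (QP.<⇒≤ 0<s) m)))
    where
    m = suc (suc k)
    split : ∀ v c t → v - c - 1ℚ ≡ (v - 1ℚ - t) + (t - c)
    split = solve-∀ ℚ-ring

  coefficientSum≡ : ∀ m → m ≥ 1 →
    coefB r m + coefC r m + coefD r m ≡ - (coefB r m * (lucasV m - (- s) ^ℚ m - 1ℚ))
  coefficientSum≡ m m≥1 = begin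
    coefB r m + coefC r m + coefD r m
      ≡⟨ cong₂ (λ c d → coefB r m + c + d) (coefC≡ m m≥1) (coefD≡ m) ⟩
    coefB r m + - (coefB r m * lucasV m) + coefB r m * (- s) ^ℚ m
      ≡⟨ factor (coefB r m) (lucasV m) ((- s) ^ℚ m) ⟩
    - (coefB r m * (lucasV m - (- s) ^ℚ m - 1ℚ)) ∎
    where
    factor : ∀ b v c → b + - (b * v) + b * c ≡ - (b * (v - c - 1ℚ))
    factor = solve-∀ ℚ-ring

  coefficientSum<0 : ∀ m → m ≥ 1 → coefB r m + coefC r m + coefD r m < 0ℚ
  coefficientSum<0 m m≥1 = subst (_< 0ℚ) (sym (coefficientSum≡ m m≥1))
    (QP.neg-antimono-< (*-pos (^ℚ-pos (QP.positive⁻¹ (ℕ→ℚ 2)) m) (0<V-[-s]ᵐ-1 m m≥1)))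

  sumTo-identity : ∀ m → m ≥ 1 → ∀ n →
    sumTo (λ k → P r (+ (k N.* m))) n * (coefB r m + coefC r m + coefD r m)
      ≡ coefA r m - (coefB r m * P r (+ (m N.* suc n)) - coefD r m * P r (+ (m N.* n)))
  sumTo-identity m m≥1 n = begin
    S * (coefB r m + coefC r m + coefD r m)
      ≡⟨ cong (S *_) (coefficientSum≡ m m≥1) ⟩
    S * - (b * (lucasV m - c - 1ℚ))
      ≡⟨ rearrange S b (lucasV m - c - 1ℚ) ⟩
    - (b * (S * (lucasV m - c - 1ℚ)))
      ≡⟨ cong (λ z → - (b * z))
           (LinearRecurrence.sumTo-solution (lucasV m) (- c) (stride-solves R s Ppos-solves m) n) ⟩
    - (b * (x (suc n) + - c * x n - x 1 + 0ℚ * (lucasV m - 1ℚ)))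
      ≡⟨ expand b c (lucasV m) (x 1) (x (suc n)) (x n) ⟩
    b * x 1 - (b * x (suc n) - b * c * x n)
      ≡⟨ cong₂ _-_ (cong (λ k → b * Ppos r k) (NP.+-identityʳ m))
           (cong₂ _-_ (cong (λ k → b * Ppos r k) (NP.*-comm (suc n) m))
                      (cong₂ _*_ (sym (coefD≡ m)) (cong (Ppos r) (NP.*-comm n m)))) ⟩
    coefA r m - (coefB r m * P r (+ (m N.* suc n)) - coefD r m * P r (+ (m N.* n))) ∎
    where
    x : ℕ → ℚ
    x k = Ppos r (k N.* m)
    S = sumTo x n
    b = coefB r m
    c = (- s) ^ℚ m
    rearrange : ∀ S b d → S * - (b * d) ≡ - (b * (S * d))
    rearrange = solve-∀ ℚ-ring
    expand : ∀ b c v x₁ y z → - (b * (y + - c * z - x₁ + 0ℚ * (v - 1ℚ))) ≡ b * x₁ - (b * y - b * c * z)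
    expand = solve-∀ ℚ-ring

mainTheorem3 : (r m : ℕ) → m ≥ 1 →
    Σ (coefB r m + coefC r m + coefD r m ≢ 0ℚ) λ h →
      (n : ℕ) →
        sumTo (λ k → P r (+ (k N.* m))) n
          ≡ _÷_ (coefA r m) (coefB r m + coefC r m + coefD r m) {{≢-nonZero h}}
            - _÷_ (coefB r m * P r (+ (m N.* suc n)) - coefD r m * P r (+ (m N.* n))) (coefB r m + coefC r m + coefD r m) {{≢-nonZero h}}
mainTheorem3 r m m≥1 = coefficientSum≢0 , λ n →
  *≡⇒≡÷ (coefA r m) (coefB r m * P r (+ (m N.* suc n)) - coefD r m * P r (+ (m N.* n)))
    {{≢-nonZero coefficientSum≢0}} (sumTo-identity m m≥1 n)
  where
  open GeneralizedPell r
  coefficientSum≢0 : coefB r m + coefC r m + coefD r m ≢ 0ℚ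
  coefficientSum≢0 = QP.<⇒≢ (coefficientSum<0 m m≥1)
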